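{- Let $k$ be a positive integer and let $a_1,\dots,a_{2k},b_1,\dots,b_{2k}$ be indeterminates. Set $W_{u,v}=a_ub_v-a_vb_u$ for $u,v=1,\dots,2k$. Let $M$ be the $k\times k$ matrix (with entries in $\mathbb{R}[a_1,\dots,a_{2k},b_1,\dots,b_{2k}]$) given by $$M_{h,H}=\Big(\prod_{i=1}^k W_{i,k+H}\Big)\Big/W_{h,k+H}=\prod_{1\le i\le k,\ i\ne h}W_{i,k+H}\qquad (h,H=1,\dots,k).$$ Then $$\det(M)=(-1)^{k(k-1)/2}\Big(\prod_{1\le h_1<h_2\le k}W_{h_1,h_2}\Big)\Big(\prod_{1\le H_1<H_2\le k}W_{k+H_1,k+H_2}\Big).$$ -}

module Defs where

open import Level using (Level)
open import Data.Nat using (ℕ; zero; suc; _∸_) renaming (_*_ to _*ℕ_; _+_ to _+ℕ_)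
open import Data.Nat.DivMod using (_/_)
open import Data.Fin using (Fin; zero; suc; toℕ; punchIn; _↑ˡ_; _↑ʳ_; _<?_; _≟_)
open import Relation.Nullary using (yes; no)
open import Algebra.Bundles using (CommutativeRing)

module _ {c ℓ : Level} (R : CommutativeRing c ℓ) where
  open CommutativeRing R using (Carrier; _+_; _*_; -_; _-_; 0#; 1#)

  pow : Carrier → ℕ → Carrier
  pow x zero    = 1#
  pow x (suc n) = x * pow x n

  sumF : ∀ n → (Fin n → Carrier) → Carrier
  sumF zero    f = 0#
  sumF (suc n) f = f zero + sumF n (λ i → f (suc i))

  prodF : ∀ n → (Fin n → Carrier) → Carrier
  prodF zero    f = 1#
  prodF (suc n) f = f zero * prodF n (λ i → f (suc i))

  prodPairs : ∀ n → (Fin n → Fin n → Carrier) → Carrier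
  prodPairs n f = prodF n (λ i → prodF n (λ j → ind i j))
    where
    ind : Fin n → Fin n → Carrier
    ind i j with i <? j
    ... | yes _ = f i j
    ... | no  _ = 1#

  det : ∀ n → (Fin n → Fin n → Carrier) → Carrier
  det zero    M = 1#
  det (suc n) M =
    sumF (suc n) (λ j → pow (- 1#) (toℕ j) * M zero j
                         * det n (λ r s → M (suc r) (punchIn j s)))

  -- W_{u,v} = a_u b_v - a_v b_u, indices in Fin (k +ℕ k) (0-based)
  W : ∀ k → (a b : Fin (k +ℕ k) → Carrier) → Fin (k +ℕ k) → Fin (k +ℕ k) → Carrier
  W k a b u v = a u * b v - a v * b u

  Mat : ∀ k → (a b : Fin (k +ℕ k) → Carrier) → Fin k → Fin k → Carrier
  Mat k a b h H = prodF k (λ i → term i)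
    where
    term : Fin k → Carrier
    term i with i ≟ h
    ... | yes _ = 1#
    ... | no  _ = W k a b (i ↑ˡ k) (k ↑ʳ H)

  rhs : ∀ k → (a b : Fin (k +ℕ k) → Carrier) → Carrier
  rhs k a b =
    pow (- 1#) ((k *ℕ (k ∸ 1)) / 2)
    * prodPairs k (λ h₁ h₂ → W k a b (h₁ ↑ˡ k) (h₂ ↑ˡ k))
    * prodPairs k (λ H₁ H₂ → W k a b (k ↑ʳ H₁) (k ↑ʳ H₂))

-- Expand det M along its first row.  Writing pᵢ = (aᵢ , bᵢ), qₕ = (a₍ₖ₊ₕ₎ , b₍ₖ₊ₕ₎) and x ∧ y for the
-- 2×2 determinant, the (0, j) entry is ∏_{i≥1} (pᵢ ∧ qⱼ), and the (0, j) minor is the matrix of the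
-- same shape for p₁ … p₍ₖ₋₁₎ and the q's without qⱼ, with column H scaled by p₀ ∧ qₕ.  By induction
-- the expansion becomes ± Δ(p₁ …) · Σⱼ (−1)ʲ f(qⱼ) ∏_{t≠j} (p₀ ∧ qₜ) Δ(q without qⱼ) for the binary
-- form f(z) = ∏_{i≥1} (pᵢ ∧ z), and this sum is f(p₀) Δ(q): Lagrange interpolation of f at the k
-- points qⱼ, with the denominators cleared.  The interpolation identity is proved by induction on the
-- degree of f, peeling off one linear factor at a time with the three-term Plücker relation.

module Submission where

open import Defs
open import Level using (Level)
open import Data.Nat as ℕ using (ℕ; zero; suc)
open import Data.Fin using (Fin; zero; suc)
open import Algebra.Bundles using (CommutativeRing)

import Data.Nat.Properties as ℕ
open import Data.Nat.DivMod using (_/_; m*n/n≡m)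
open import Data.Integer as ℤ using (ℤ; +_; -[1+_]; _⊖_)
import Data.Integer.Properties as ℤ
open import Data.Fin using (toℕ; punchIn; _↑ˡ_; _↑ʳ_; _<?_; _≟_)
open import Data.Fin.Properties using (punchInᵢ≢i)
open import Data.Maybe using (map)
open import Data.Vec.Functional using (tail; removeAt)
open import Function using (_∘_)
open import Relation.Nullary using (yes; no; contradiction)
open import Relation.Nullary.Decidable using (dec⇒maybe)
open import Relation.Binary.PropositionalEquality as ≡ using (_≡_; cong)
import Algebra.Solver.Ring as RingSolver
open import Algebra.Solver.Ring.AlmostCommutativeRing
  using (fromCommutativeRing; _-Raw-AlmostCommutative⟶_)

module IntegerCoefficientSolver {c ℓ : Level} (R : CommutativeRing c ℓ) where
  open CommutativeRing R
  open import Algebra.Properties.Ring ring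
    using (-0#≈0#; -‿involutive; -‿+-comm; -‿anti-homo-+; xyx⁻¹≈y; -‿distribˡ-*; -‿distribʳ-*)
  open import Algebra.Properties.Semiring.Mult.TCOptimised semiring
    using (_×_; 1+×; ×-homo-+; ×1-homo-*)
  open import Relation.Binary.Reasoning.Setoid setoid

  -- The ring solver needs coefficients whose equality is decidable, hence ℤ mapped into R.  With the
  -- type-checking-optimised multiple, ι (+ 1) is 1# definitionally, so con (+ 1) denotes 1# in goals.
  ι : ℤ → Carrier
  ι (+ n)    = n × 1#
  ι -[1+ n ] = - (suc n × 1#)

  ι-neg : ∀ i → ι (ℤ.- i) ≈ - ι i
  ι-neg (+ zero)  = sym -0#≈0#
  ι-neg (+ suc n) = refl
  ι-neg -[1+ n ]  = sym (-‿involutive _)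

  ι-⊖ : ∀ m n → ι (m ⊖ n) ≈ m × 1# - n × 1#
  ι-⊖ m       zero    = sym (trans (+-congˡ -0#≈0#) (+-identityʳ _))
  ι-⊖ zero    (suc n) = sym (+-identityˡ _)
  ι-⊖ (suc m) (suc n) = begin
    ι (suc m ⊖ suc n)                 ≡⟨ cong ι (ℤ.[1+m]⊖[1+n]≡m⊖n m n) ⟩
    ι (m ⊖ n)                         ≈⟨ ι-⊖ m n ⟩
    m × 1# - n × 1#                   ≈⟨ xyx⁻¹≈y 1# _ ⟨
    1# + (m × 1# - n × 1#) - 1#       ≈⟨ +-congʳ (+-assoc 1# _ _) ⟨
    1# + m × 1# + - (n × 1#) + - 1#   ≈⟨ +-assoc _ _ _ ⟩
    1# + m × 1# + (- (n × 1#) + - 1#) ≈⟨ +-cong (1+× m 1#) (-‿anti-homo-+ 1# _) ⟨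
    suc m × 1# - (1# + n × 1#)        ≈⟨ +-congˡ (-‿cong (1+× n 1#)) ⟨
    suc m × 1# - suc n × 1#           ∎

  ι-+ : ∀ i j → ι (i ℤ.+ j) ≈ ι i + ι j
  ι-+ (+ m)    (+ n)    = ×-homo-+ 1# m n
  ι-+ (+ m)    -[1+ n ] = ι-⊖ m (suc n)
  ι-+ -[1+ m ] (+ n)    = trans (ι-⊖ n (suc m)) (+-comm _ _)
  ι-+ -[1+ m ] -[1+ n ] = begin
    - (suc (suc (m ℕ.+ n)) × 1#)   ≡⟨ cong (λ k → - (k × 1#)) (ℕ.+-suc (suc m) n) ⟨
    - ((suc m ℕ.+ suc n) × 1#)     ≈⟨ -‿cong (×-homo-+ 1# (suc m) (suc n)) ⟩
    - (suc m × 1# + suc n × 1#)    ≈⟨ -‿+-comm _ _ ⟨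
    - (suc m × 1#) - suc n × 1#    ∎

  ι-*-pos : ∀ m n → ι (+ m ℤ.* + n) ≈ ι (+ m) * ι (+ n)
  ι-*-pos m n = trans (reflexive (cong ι (≡.sym (ℤ.pos-* m n)))) (×1-homo-* m n)

  ι-*-neg : ∀ i j → ι (i ℤ.* j) ≈ ι i * ι j → ι (i ℤ.* ℤ.- j) ≈ ι i * ι (ℤ.- j)
  ι-*-neg i j ιij = begin
    ι (i ℤ.* ℤ.- j)   ≡⟨ cong ι (ℤ.neg-distribʳ-* i j) ⟨
    ι (ℤ.- (i ℤ.* j)) ≈⟨ ι-neg (i ℤ.* j) ⟩
    - ι (i ℤ.* j)     ≈⟨ -‿cong ιij ⟩
    - (ι i * ι j)     ≈⟨ -‿distribʳ-* _ _ ⟩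
    ι i * - ι j       ≈⟨ *-congˡ (ι-neg j) ⟨
    ι i * ι (ℤ.- j)   ∎

  ι-*⁺ : ∀ m j → ι (+ m ℤ.* j) ≈ ι (+ m) * ι j
  ι-*⁺ m (+ n)    = ι-*-pos m n
  ι-*⁺ m -[1+ n ] = ι-*-neg (+ m) (+ suc n) (ι-*-pos m (suc n))

  ι-* : ∀ i j → ι (i ℤ.* j) ≈ ι i * ι j
  ι-* (+ m)    j = ι-*⁺ m j
  ι-* -[1+ m ] j = begin
    ι (-[1+ m ] ℤ.* j)       ≡⟨ cong ι (ℤ.neg-distribˡ-* (+ suc m) j) ⟨
    ι (ℤ.- (+ suc m ℤ.* j))  ≈⟨ ι-neg (+ suc m ℤ.* j) ⟩
    - ι (+ suc m ℤ.* j)      ≈⟨ -‿cong (ι-*⁺ (suc m) j) ⟩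
    - (ι (+ suc m) * ι j)    ≈⟨ -‿distribˡ-* _ _ ⟩
    ι -[1+ m ] * ι j         ∎

  ι-homomorphism : ℤ.+-*-rawRing -Raw-AlmostCommutative⟶ fromCommutativeRing R
  ι-homomorphism = record
    { ⟦_⟧ = ι ; +-homo = ι-+ ; *-homo = ι-* ; -‿homo = ι-neg ; 0-homo = refl ; 1-homo = refl }

  open RingSolver ℤ.+-*-rawRing (fromCommutativeRing R) ι-homomorphism
    (λ i j → map (reflexive ∘ cong ι) (dec⇒maybe (i ℤ.≟ j))) public

triangular : ℕ → ℕ
triangular zero    = 0
triangular (suc n) = triangular n ℕ.+ n

triangular*2 : ∀ n → triangular n ℕ.* 2 ≡ n ℕ.* (n ℕ.∸ 1)
triangular*2 zero          = ≡.refl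
triangular*2 (suc zero)    = ≡.refl
triangular*2 (suc (suc n)) = begin
  (triangular (suc n) ℕ.+ suc n) ℕ.* 2       ≡⟨ ℕ.*-distribʳ-+ 2 (triangular (suc n)) (suc n) ⟩
  triangular (suc n) ℕ.* 2 ℕ.+ suc n ℕ.* 2   ≡⟨ cong (ℕ._+ suc n ℕ.* 2) (triangular*2 (suc n)) ⟩
  suc n ℕ.* n ℕ.+ suc n ℕ.* 2                ≡⟨ ℕ.*-distribˡ-+ (suc n) n 2 ⟨
  suc n ℕ.* (n ℕ.+ 2)                        ≡⟨ cong (suc n ℕ.*_) (ℕ.+-comm n 2) ⟩
  suc n ℕ.* suc (suc n)                      ≡⟨ ℕ.*-comm (suc n) (suc (suc n)) ⟩
  suc (suc n) ℕ.* suc n                      ∎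
  where open ≡.≡-Reasoning

n*[n∸1]/2≡triangular : ∀ n → n ℕ.* (n ℕ.∸ 1) / 2 ≡ triangular n
n*[n∸1]/2≡triangular n = ≡.trans (cong (_/ 2) (≡.sym (triangular*2 n))) (m*n/n≡m (triangular n) 2)

module BracketDeterminant {c ℓ : Level} (R : CommutativeRing c ℓ) where
  open CommutativeRing R hiding (zero)
  open import Data.Product using (_×_; _,_)
  open IntegerCoefficientSolver R using (solve; _:=_; _:+_; _:-_; _:*_; :-_; con)
  open import Algebra.Properties.Ring ring using (-‿distribˡ-*)
  open import Algebra.Properties.Semiring.Sum semiring
    using (sum-cong-≋; ∑-distrib-+; *-distribˡ-sum) renaming (sum to ∑)
  open import Algebra.Properties.CommutativeMonoid.Sum *-commutativeMonoid
    using () renaming (sum to ∏; sum-cong-≋ to ∏-cong; sum-remove to ∏-remove)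
  open import Relation.Binary.Reasoning.Setoid setoid

  infix 8 -1^_

  -1^_ : ℕ → Carrier
  -1^ n = pow R (- 1#) n

  -1^-+ : ∀ m n → -1^ (m ℕ.+ n) ≈ -1^ m * -1^ n
  -1^-+ zero    n = sym (*-identityˡ _)
  -1^-+ (suc m) n = trans (*-congˡ (-1^-+ m n)) (sym (*-assoc _ _ _))

  sumF≡∑ : ∀ n (f : Fin n → Carrier) → sumF R n f ≡ ∑ f
  sumF≡∑ zero    f = ≡.refl
  sumF≡∑ (suc n) f = cong (_+_ (f zero)) (sumF≡∑ n (tail f))

  prodF≗∏ : ∀ n {f g : Fin n → Carrier} → (∀ i → f i ≡ g i) → prodF R n f ≡ ∏ g
  prodF≗∏ zero    f≗g = ≡.refl
  prodF≗∏ (suc n) f≗g = ≡.cong₂ _*_ (f≗g zero) (prodF≗∏ n (f≗g ∘ suc))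

  ∑-linear : ∀ {n} a b (f g : Fin n → Carrier) →
             ∑ (λ j → a * f j - b * g j) ≈ a * ∑ f - b * ∑ g
  ∑-linear a b f g = begin
    ∑ (λ j → a * f j - b * g j)               ≈⟨ sum-cong-≋ (λ j → +-congˡ (-‿distribˡ-* b (g j))) ⟩
    ∑ (λ j → a * f j + - b * g j)             ≈⟨ ∑-distrib-+ (λ j → a * f j) (λ j → - b * g j) ⟩
    ∑ (λ j → a * f j) + ∑ (λ j → - b * g j)   ≈⟨ +-cong (*-distribˡ-sum a f) (*-distribˡ-sum (- b) g) ⟨
    a * ∑ f + - b * ∑ g                       ≈⟨ +-congˡ (-‿distribˡ-* b (∑ g)) ⟨
    a * ∑ f - b * ∑ g                         ∎

  minor : ∀ {n} → (Fin (suc n) → Fin (suc n) → Carrier) → Fin (suc n) → Fin n → Fin n → Carrier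
  minor M j r s = M (suc r) (punchIn j s)

  det-suc : ∀ n M → det R (suc n) M ≡ ∑ (λ j → -1^ toℕ j * M zero j * det R n (minor M j))
  det-suc n M = sumF≡∑ (suc n) (λ j → -1^ toℕ j * M zero j * det R n (minor M j))

  det-cong : ∀ n {M N : Fin n → Fin n → Carrier} → (∀ i j → M i j ≈ N i j) → det R n M ≈ det R n N
  det-cong zero    M≈N = refl
  det-cong (suc n) {M} {N} M≈N = begin
    det R (suc n) M                                             ≡⟨ det-suc n M ⟩
    ∑ (λ j → -1^ toℕ j * M zero j * det R n (minor M j))       ≈⟨ sum-cong-≋ expansion≈ ⟩
    ∑ (λ j → -1^ toℕ j * N zero j * det R n (minor N j))       ≡⟨ det-suc n N ⟨
    det R (suc n) N                                             ∎
    where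
    expansion≈ : ∀ j → -1^ toℕ j * M zero j * det R n (minor M j) ≈ -1^ toℕ j * N zero j * det R n (minor N j)
    expansion≈ j = *-cong (*-congˡ (M≈N zero j)) (det-cong n (λ r s → M≈N (suc r) (punchIn j s)))

  det-scaleColumns : ∀ n (c : Fin n → Carrier) (N : Fin n → Fin n → Carrier) →
                     det R n (λ i j → c j * N i j) ≈ ∏ c * det R n N
  det-scaleColumns zero    c N = sym (*-identityˡ 1#)
  det-scaleColumns (suc n) c N = begin
    det R (suc n) (λ i j → c j * N i j)         ≡⟨ det-suc n (λ i j → c j * N i j) ⟩
    ∑ (λ j → -1^ toℕ j * (c j * N zero j) * det R n (λ r s → c (punchIn j s) * minor N j r s))
      ≈⟨ sum-cong-≋ expand ⟩
    ∑ (λ j → ∏ c * (-1^ toℕ j * N zero j * det R n (minor N j)))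
      ≈⟨ *-distribˡ-sum (∏ c) (λ j → -1^ toℕ j * N zero j * det R n (minor N j)) ⟨
    ∏ c * ∑ (λ j → -1^ toℕ j * N zero j * det R n (minor N j))
      ≡⟨ cong (∏ c *_) (det-suc n N) ⟨
    ∏ c * det R (suc n) N                       ∎
    where
    expand : ∀ j → -1^ toℕ j * (c j * N zero j) * det R n (λ r s → c (punchIn j s) * minor N j r s)
                   ≈ ∏ c * (-1^ toℕ j * N zero j * det R n (minor N j))
    expand j = begin
      -1^ toℕ j * (c j * N zero j) * det R n (λ r s → c (punchIn j s) * minor N j r s)
        ≈⟨ *-congˡ (det-scaleColumns n (removeAt c j) (minor N j)) ⟩
      -1^ toℕ j * (c j * N zero j) * (∏ (removeAt c j) * det R n (minor N j))
        ≈⟨ solve 5 (λ s x a p d → s :* (x :* a) :* (p :* d) := x :* p :* (s :* a :* d)) refl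
                 (-1^ toℕ j) (c j) (N zero j) (∏ (removeAt c j)) (det R n (minor N j)) ⟩
      c j * ∏ (removeAt c j) * (-1^ toℕ j * N zero j * det R n (minor N j))
        ≈⟨ *-congʳ (∏-remove c) ⟨
      ∏ c * (-1^ toℕ j * N zero j * det R n (minor N j)) ∎

  Point : Set c
  Point = Carrier × Carrier

  infix 8 _∧_ _Π∧_ _∧Π_

  -- W R k a b u v in Defs is definitionally (a u , b u) ∧ (a v , b v).
  _∧_ : Point → Point → Carrier
  (a , b) ∧ (c , d) = a * d - c * b

  ∧-antisym : ∀ x y → x ∧ y ≈ - (y ∧ x)
  ∧-antisym (a , b) (c , d) = solve 4 (λ a b c d → a :* d :- c :* b := :- (c :* b :- a :* d)) refl a b c d

  plücker : ∀ x y z w → (x ∧ y) * (z ∧ w) - (x ∧ z) * (y ∧ w) ≈ - ((x ∧ w) * (y ∧ z))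
  plücker (a , b) (c , d) (e , f) (g , h) =
    solve 8 (λ a b c d e f g h →
               (a :* d :- c :* b) :* (e :* h :- g :* f) :- (a :* f :- e :* b) :* (c :* h :- g :* d)
               := :- ((a :* h :- g :* b) :* (c :* f :- e :* d)))
            refl a b c d e f g h

  _Π∧_ : ∀ {n} → (Fin n → Point) → Point → Carrier
  u Π∧ z = ∏ (λ i → u i ∧ z)

  _∧Π_ : ∀ {n} → Point → (Fin n → Point) → Carrier
  x ∧Π s = ∏ (λ t → x ∧ s t)

  Π∧-flip : ∀ {n} (u : Fin n → Point) x → u Π∧ x ≈ -1^ n * (x ∧Π u)
  Π∧-flip {zero}  u x = sym (*-identityˡ 1#)
  Π∧-flip {suc n} u x = begin
    (u zero ∧ x) * (tail u Π∧ x)                  ≈⟨ *-cong (∧-antisym (u zero) x) (Π∧-flip (tail u) x) ⟩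
    - (x ∧ u zero) * (-1^ n * (x ∧Π tail u))      ≈⟨ solve 3 (λ w s p → :- w :* (s :* p) := :- con (+ 1) :* s :* (w :* p)) refl
                                                          (x ∧ u zero) (-1^ n) (x ∧Π tail u) ⟩
    -1^ suc n * (x ∧Π u)                          ∎

  Δ : ∀ {n} → (Fin n → Point) → Carrier
  Δ {zero}  x = 1#
  Δ {suc n} x = (x zero ∧Π tail x) * Δ (tail x)

  lagrangeTerm : ∀ {n} → Point → (Fin n → Point) → (Fin (suc n) → Point) → Fin (suc n) → Carrier
  lagrangeTerm x u r j = -1^ toℕ j * (u Π∧ r j) * (x ∧Π removeAt r j) * Δ (removeAt r j)

  lagrangeTerm-suc : ∀ {n} x (u : Fin (suc n) → Point) (r : Fin (suc (suc n)) → Point) j →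
    lagrangeTerm x u r (suc j)
      ≈ (u zero ∧ x) * (r zero ∧Π tail r) * lagrangeTerm x (tail u) (tail r) j
        - (u zero ∧ r zero) * (x ∧Π tail r) * lagrangeTerm (r zero) (tail u) (tail r) j
  lagrangeTerm-suc x u r j = begin
    - 1# * s * ((u₀ ∧ rⱼ) * F) * ((x ∧ r₀) * Gₓ) * (Gᵣ * D)
      ≈⟨ solve 7 (λ s a f b gx gr d → :- con (+ 1) :* s :* (a :* f) :* (b :* gx) :* (gr :* d)
                                      := :- (a :* b) :* (s :* f :* gx :* gr :* d))
               refl s (u₀ ∧ rⱼ) F (x ∧ r₀) Gₓ Gᵣ D ⟩
    - ((u₀ ∧ rⱼ) * (x ∧ r₀)) * (s * F * Gₓ * Gᵣ * D)
      ≈⟨ *-congʳ (plücker u₀ x r₀ rⱼ) ⟨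
    ((u₀ ∧ x) * (r₀ ∧ rⱼ) - (u₀ ∧ r₀) * (x ∧ rⱼ)) * (s * F * Gₓ * Gᵣ * D)
      ≈⟨ solve 9 (λ ax brj ar bx s f gx gr d →
                    (ax :* brj :- ar :* bx) :* (s :* f :* gx :* gr :* d)
                    := ax :* (brj :* gr) :* (s :* f :* gx :* d) :- ar :* (bx :* gx) :* (s :* f :* gr :* d))
               refl (u₀ ∧ x) (r₀ ∧ rⱼ) (u₀ ∧ r₀) (x ∧ rⱼ) s F Gₓ Gᵣ D ⟩
    (u₀ ∧ x) * ((r₀ ∧ rⱼ) * Gᵣ) * (s * F * Gₓ * D) - (u₀ ∧ r₀) * ((x ∧ rⱼ) * Gₓ) * (s * F * Gᵣ * D)
      ≈⟨ +-cong (*-congʳ (*-congˡ (∏-remove (λ t → r₀ ∧ tail r t))))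
                (-‿cong (*-congʳ (*-congˡ (∏-remove (λ t → x ∧ tail r t))))) ⟨
    (u₀ ∧ x) * (r₀ ∧Π tail r) * lagrangeTerm x (tail u) (tail r) j
      - (u₀ ∧ r₀) * (x ∧Π tail r) * lagrangeTerm r₀ (tail u) (tail r) j ∎
    where
    u₀ = u zero
    r₀ = r zero
    rⱼ = tail r j
    s  = -1^ toℕ j
    F  = tail u Π∧ rⱼ
    Gₓ = x ∧Π removeAt (tail r) j
    Gᵣ = r₀ ∧Π removeAt (tail r) j
    D  = Δ (removeAt (tail r) j)

  lagrange-interpolation : ∀ {n} x (u : Fin n → Point) r → ∑ (lagrangeTerm x u r) ≈ (u Π∧ x) * Δ r
  lagrange-interpolation {zero} x u r =
    solve 0 (con (+ 1) :* con (+ 1) :* con (+ 1) :* con (+ 1) :+ con (+ 0) := con (+ 1) :* (con (+ 1) :* con (+ 1))) refl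
  lagrange-interpolation {suc n} x u r = begin
    lagrangeTerm x u r zero + ∑ (lagrangeTerm x u r ∘ suc)
      ≈⟨ +-congˡ (sum-cong-≋ (lagrangeTerm-suc x u r)) ⟩
    lagrangeTerm x u r zero + ∑ (λ j → A * lagrangeTerm x u′ r′ j - B * lagrangeTerm r₀ u′ r′ j)
      ≈⟨ +-congˡ (∑-linear A B (lagrangeTerm x u′ r′) (lagrangeTerm r₀ u′ r′)) ⟩
    lagrangeTerm x u r zero + (A * ∑ (lagrangeTerm x u′ r′) - B * ∑ (lagrangeTerm r₀ u′ r′))
      ≈⟨ +-congˡ (+-cong (*-congˡ (lagrange-interpolation x u′ r′))
                         (-‿cong (*-congˡ (lagrange-interpolation r₀ u′ r′)))) ⟩
    lagrangeTerm x u r zero + (A * ((u′ Π∧ x) * Δ r′) - B * ((u′ Π∧ r₀) * Δ r′))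
      ≈⟨ solve 7 (λ ar fr gx d ax gr fx →
                    con (+ 1) :* (ar :* fr) :* gx :* d :+ (ax :* gr :* (fx :* d) :- ar :* gx :* (fr :* d))
                    := ax :* fx :* (gr :* d))
               refl (u zero ∧ r₀) (u′ Π∧ r₀) (x ∧Π r′) (Δ r′) (u zero ∧ x) (r₀ ∧Π r′) (u′ Π∧ x) ⟩
    (u Π∧ x) * Δ r ∎
    where
    u′ = tail u
    r₀ = r zero
    r′ = tail r
    A  = (u zero ∧ x) * (r₀ ∧Π r′)
    B  = (u zero ∧ r₀) * (x ∧Π r′)

  brackets : ∀ {n} (p r : Fin (suc n) → Point) → Fin (suc n) → Fin (suc n) → Carrier
  brackets p r h H = removeAt p h Π∧ r H

  det-brackets : ∀ n (p r : Fin (suc n) → Point) →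
                 det R (suc n) (brackets p r) ≈ -1^ triangular (suc n) * Δ p * Δ r
  det-brackets zero p r =
    solve 0 (con (+ 1) :* con (+ 1) :* con (+ 1) :+ con (+ 0)
             := con (+ 1) :* (con (+ 1) :* con (+ 1)) :* (con (+ 1) :* con (+ 1))) refl
  det-brackets (suc n) p r = begin
    det R (suc (suc n)) (brackets p r)
      ≡⟨ det-suc (suc n) (brackets p r) ⟩
    ∑ (λ j → -1^ toℕ j * (p′ Π∧ r j) * det R (suc n) (minor (brackets p r) j))
      ≈⟨ sum-cong-≋ expand ⟩
    ∑ (λ j → σ * Δ p′ * lagrangeTerm p₀ p′ r j)
      ≈⟨ *-distribˡ-sum (σ * Δ p′) (lagrangeTerm p₀ p′ r) ⟨
    σ * Δ p′ * ∑ (lagrangeTerm p₀ p′ r)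
      ≈⟨ *-congˡ (lagrange-interpolation p₀ p′ r) ⟩
    σ * Δ p′ * ((p′ Π∧ p₀) * Δ r)
      ≈⟨ *-congˡ (*-congʳ (Π∧-flip p′ p₀)) ⟩
    σ * Δ p′ * (-1^ suc n * (p₀ ∧Π p′) * Δ r)
      ≈⟨ solve 5 (λ σ d τ g e → σ :* d :* (τ :* g :* e) := σ :* τ :* (g :* d) :* e) refl
               σ (Δ p′) (-1^ suc n) (p₀ ∧Π p′) (Δ r) ⟩
    σ * -1^ suc n * Δ p * Δ r
      ≈⟨ *-congʳ (*-congʳ (-1^-+ (triangular (suc n)) (suc n))) ⟨
    -1^ triangular (suc (suc n)) * Δ p * Δ r ∎
    where
    p₀ = p zero
    p′ = tail p
    σ  = -1^ triangular (suc n)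
    expand : ∀ j → -1^ toℕ j * (p′ Π∧ r j) * det R (suc n) (minor (brackets p r) j)
                   ≈ σ * Δ p′ * lagrangeTerm p₀ p′ r j
    expand j = begin
      -1^ toℕ j * (p′ Π∧ r j) * det R (suc n) (λ h H → (p₀ ∧ rⱼ′ H) * brackets p′ rⱼ′ h H)
        ≈⟨ *-congˡ (det-scaleColumns (suc n) (λ H → p₀ ∧ rⱼ′ H) (brackets p′ rⱼ′)) ⟩
      -1^ toℕ j * (p′ Π∧ r j) * ((p₀ ∧Π rⱼ′) * det R (suc n) (brackets p′ rⱼ′))
        ≈⟨ *-congˡ (*-congˡ (det-brackets n p′ rⱼ′)) ⟩
      -1^ toℕ j * (p′ Π∧ r j) * ((p₀ ∧Π rⱼ′) * (σ * Δ p′ * Δ rⱼ′))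
        ≈⟨ solve 6 (λ s f g σ d e → s :* f :* (g :* (σ :* d :* e)) := σ :* d :* (s :* f :* g :* e)) refl
                 (-1^ toℕ j) (p′ Π∧ r j) (p₀ ∧Π rⱼ′) σ (Δ p′) (Δ rⱼ′) ⟩
      σ * Δ p′ * lagrangeTerm p₀ p′ r j ∎
      where
      rⱼ′ = removeAt r j

  above : ∀ {n} → (Fin n → Fin n → Carrier) → Fin n → Fin n → Carrier
  above f i j with i <? j
  ... | yes _ = f i j
  ... | no  _ = 1#

  above-suc : ∀ {n} (f : Fin (suc n) → Fin (suc n) → Carrier) i j →
              above f (suc i) (suc j) ≡ above (λ i j → f (suc i) (suc j)) i j
  above-suc f i j with i <? j | suc i <? suc j
  ... | yes _   | yes _   = ≡.refl
  ... | no  _   | no  _   = ≡.refl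
  ... | yes i<j | no  i≮j = contradiction (ℕ.s<s i<j) i≮j
  ... | no  i≮j | yes i<j = contradiction (ℕ.s<s⁻¹ i<j) i≮j

  ∏-above≈Δ : ∀ {n} (x : Fin n → Point) → ∏ (λ i → ∏ (above (λ i j → x i ∧ x j) i)) ≈ Δ x
  ∏-above≈Δ {zero}  x = refl
  ∏-above≈Δ {suc n} x = begin
    1# * (x zero ∧Π tail x) * ∏ (λ i → 1# * ∏ (above x∧x (suc i) ∘ suc))
      ≈⟨ *-cong (*-identityˡ _) (∏-cong (λ i → trans (*-identityˡ _) (∏-cong (reflexive ∘ above-suc x∧x i)))) ⟩
    (x zero ∧Π tail x) * ∏ (λ i → ∏ (above (λ i j → x (suc i) ∧ x (suc j)) i))
      ≈⟨ *-congˡ (∏-above≈Δ (tail x)) ⟩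
    Δ x ∎
    where
    x∧x = λ i j → x i ∧ x j

  omit : ∀ {n} → Fin n → (Fin n → Carrier) → Fin n → Carrier
  omit h f i with i ≟ h
  ... | yes _ = 1#
  ... | no  _ = f i

  ∏-omit : ∀ {n} h (f : Fin (suc n) → Carrier) → ∏ (omit h f) ≈ ∏ (removeAt f h)
  ∏-omit h f = begin
    ∏ (omit h f)                            ≈⟨ ∏-remove {i = h} (omit h f) ⟩
    omit h f h * ∏ (removeAt (omit h f) h)  ≈⟨ *-cong omit-self (∏-cong omit-punchIn) ⟩
    1# * ∏ (removeAt f h)                   ≈⟨ *-identityˡ _ ⟩
    ∏ (removeAt f h)                        ∎
    where
    omit-self : omit h f h ≈ 1#
    omit-self with h ≟ h
    ... | yes _   = refl
    ... | no  h≢h = contradiction ≡.refl h≢h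
    omit-punchIn : ∀ i → omit h f (punchIn h i) ≈ f (punchIn h i)
    omit-punchIn i with punchIn h i ≟ h
    ... | yes eq = contradiction eq (punchInᵢ≢i h i)
    ... | no  _  = refl

  -- The entries of prodPairs and of Mat are local to Defs; the types of prodPairs-entry and
  -- Mat-entry are therefore left to be inferred from their use in the same mutual block.
  mutual
    prodPairs≡∏-above : ∀ n f → prodPairs R n f ≡ ∏ (λ i → ∏ (above f i))
    prodPairs≡∏-above n f = prodF≗∏ n (λ i → prodF≗∏ n (prodPairs-entry f i))

    prodPairs-entry : ∀ {n} f i j → _ ≡ above {n} f i j
    prodPairs-entry f i j with i <? j
    ... | yes _ = ≡.refl
    ... | no  _ = ≡.refl

  mutual
    Mat≡∏-omit : ∀ k a b h H → Mat R k a b h H ≡ ∏ (omit h (λ i → W R k a b (i ↑ˡ k) (k ↑ʳ H)))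
    Mat≡∏-omit k a b h H = prodF≗∏ k (Mat-entry k a b h H)

    Mat-entry : ∀ k a b h H i → _ ≡ omit h (λ i → W R k a b (i ↑ˡ k) (k ↑ʳ H)) i
    Mat-entry k a b h H i with i ≟ h
    ... | yes _ = ≡.refl
    ... | no  _ = ≡.refl

  prodPairs-∧≈Δ : ∀ n (x : Fin n → Point) → prodPairs R n (λ i j → x i ∧ x j) ≈ Δ x
  prodPairs-∧≈Δ n x = trans (reflexive (prodPairs≡∏-above n _)) (∏-above≈Δ x)

  firstHalf secondHalf : ∀ k → (a b : Fin (k ℕ.+ k) → Carrier) → Fin k → Point
  firstHalf  k a b i = a (i ↑ˡ k) , b (i ↑ˡ k)
  secondHalf k a b i = a (k ↑ʳ i) , b (k ↑ʳ i)

  Mat≈brackets : ∀ n a b h H →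
                 Mat R (suc n) a b h H ≈ brackets (firstHalf (suc n) a b) (secondHalf (suc n) a b) h H
  Mat≈brackets n a b h H = trans (reflexive (Mat≡∏-omit (suc n) a b h H)) (∏-omit h _)

-- Opened only here: inside the modules above, _+_ is the ring addition.
open import Data.Nat using (_≤_; _+_)

lemma5p1 : ∀ {c ℓ : Level} (R : CommutativeRing c ℓ) (k : ℕ) → 1 ≤ k
    → (a b : Fin (k + k) → CommutativeRing.Carrier R)
    → CommutativeRing._≈_ R (det R k (Mat R k a b)) (rhs R k a b)
lemma5p1 R (suc n) _ a b = begin
  det R (suc n) (Mat R (suc n) a b)    ≈⟨ det-cong (suc n) (Mat≈brackets n a b) ⟩
  det R (suc n) (brackets p q)         ≈⟨ det-brackets n p q ⟩
  -1^ triangular (suc n) * Δ p * Δ q   ≈⟨ *-cong (*-cong sign (sym (prodPairs-∧≈Δ (suc n) p)))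
                                                 (sym (prodPairs-∧≈Δ (suc n) q)) ⟩
  rhs R (suc n) a b                    ∎
  where
  open CommutativeRing R using (_≈_; _*_; -_; 1#; sym; reflexive; *-cong; setoid)
  open BracketDeterminant R
  open import Relation.Binary.Reasoning.Setoid setoid
  p = firstHalf (suc n) a b
  q = secondHalf (suc n) a b
  sign : -1^ triangular (suc n) ≈ pow R (- 1#) (suc n ℕ.* n / 2)
  sign = reflexive (cong (pow R (- 1#)) (≡.sym (n*[n∸1]/2≡triangular (suc n))))
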